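{- Let $P=(X,\le)$ be a poset and $\mathcal{M}$ a collection of subsets of $X$ containing all singletons. If $P$ is $\mathcal{M}$-continuous, then $y=\bigvee\twoheaddownarrow_{\mathcal{M}}(\twoheaddownarrow_{\mathcal{M}} y)$ for all $y\in X$. Moreover, $P$ is strongly $\mathcal{M}$-continuous if and only if for all $y\in X$, $\twoheaddownarrow_{\mathcal{M}}(\twoheaddownarrow_{\mathcal{M}} y)\in\mathcal{M}^\wedge$ and $y=\bigvee\twoheaddownarrow_{\mathcal{M}}(\twoheaddownarrow_{\mathcal{M}} y)$.
   Context: $\mathcal{M}_\vee$ is the set of members of $\mathcal{M}$ with a supremum; $\mathcal{M}^\wedge=\{\downarrow M:M\in\mathcal{M}\}$. $x\ll_{\mathcal{M}} y$ iff for all $M\in\mathcal{M}_\vee$, $y\le\bigvee M$ implies $x\in\downarrow M$. For $Y\subseteq X$, $\twoheaddownarrow_{\mathcal{M}} Y=\{x:\exists y\in Y,\ x\ll_{\mathcal{M}} y\}$, and $\twoheaddownarrow_{\mathcal{M}} y=\twoheaddownarrow_{\mathcal{M}}\{y\}$. $P$ is $\mathcal{M}$-continuous if for every $y$, $\twoheaddownarrow_{\mathcal{M}} y\in\mathcal{M}^\wedge$ and $y=\bigvee\twoheaddownarrow_{\mathcal{M}} y$; it is strongly $\mathcal{M}$-continuous if moreover $\ll_{\mathcal{M}}$ has the interpolation property ($x\ll_{\mathcal{M}} z$ implies $x\ll_{\mathcal{M}} y\ll_{\mathcal{M}} z$ for some $y$). -}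

module Defs where

open import Level using (Level; _⊔_; suc)
open import Data.Product using (Σ; ∃; _×_; _,_)
open import Relation.Binary.Bundles using (Poset)
open import Relation.Unary using (Pred; _⊆_)

module Theory {c ℓ₁ ℓ₂ : Level} (P : Poset c ℓ₁ ℓ₂) where
  open Poset P public renaming (Carrier to X)

  UpperBound : ∀ {a} → Pred X a → X → Set (c ⊔ a ⊔ ℓ₂)
  UpperBound S y = ∀ x → S x → x ≤ y

  IsSup : ∀ {a} → Pred X a → X → Set (c ⊔ a ⊔ ℓ₂)
  IsSup S y = UpperBound S y × (∀ z → UpperBound S z → y ≤ z)

  ↓ : ∀ {a} → Pred X a → Pred X (c ⊔ a ⊔ ℓ₂)
  ↓ S x = ∃ λ s → S s × x ≤ s

  ｛_｝ : X → Pred X ℓ₁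
  ｛ x ｝ z = z ≈ x

  module WithM {ℓ ℓm : Level} (𝓜 : Pred (Pred X ℓ) ℓm) where

    ContainsSingletons : Set _
    ContainsSingletons = ∀ x → ∃ λ (M : Pred X ℓ) → 𝓜 M × M ⊆ ｛ x ｝ × ｛ x ｝ ⊆ M

    _≪_ : X → X → Set (c ⊔ suc ℓ ⊔ ℓm ⊔ ℓ₂)
    x ≪ y = ∀ (M : Pred X ℓ) → 𝓜 M → ∀ s → IsSup M s → y ≤ s → ↓ M x

    ↠ : ∀ {a} → Pred X a → Pred X (c ⊔ a ⊔ suc ℓ ⊔ ℓm ⊔ ℓ₂)
    ↠ Y x = ∃ λ y → Y y × x ≪ y

    ↠₁ : X → Pred X (c ⊔ suc ℓ ⊔ ℓm ⊔ ℓ₂ ⊔ ℓ₁)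
    ↠₁ y = ↠ ｛ y ｝

    -- S ∈ 𝓜^∧ = {↓M : M ∈ 𝓜}  (equality of subsets = mutual inclusion)
    In𝓜∧ : ∀ {a} → Pred X a → Set _
    In𝓜∧ S = ∃ λ (M : Pred X ℓ) → 𝓜 M × ↓ M ⊆ S × S ⊆ ↓ M

    Continuous : Set _
    Continuous = ∀ y → In𝓜∧ (↠₁ y) × IsSup (↠₁ y) y

    Interpolation : Set _
    Interpolation = ∀ x z → x ≪ z → ∃ λ y → x ≪ y × y ≪ z

    StronglyContinuous : Set _
    StronglyContinuous = Continuous × Interpolation

module Submission where

-- The argument rests on two inclusions between ↠y and ↠(↠y):
--   * ↠(↠y) ⊆ ↠y always holds, because ≪ implies ≤ (singletons are in 𝓜)
--     and ≪ is monotone in its right argument;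
--   * ↠y ⊆ ↠(↠y) for all y is a restatement of the interpolation property.
-- Under interpolation the two sets coincide, so membership in 𝓜^∧ and
-- suprema transfer between them.  Conversely, if ↠(↠y) ∈ 𝓜^∧ has supremum y,
-- then every x ≪ y already lies in ↠(↠y) (definition of ≪ applied to the
-- generating M ∈ 𝓜), which yields interpolation and then continuity.
-- Part (1) follows from the general fact that ↠ preserves suprema when every
-- element is the supremum of its way-below set.

open import Defs
open import Level using (Level)
open import Data.Product using (_×_; _,_; proj₁; proj₂)
open import Function.Bundles using (_⇔_; mk⇔)
open import Relation.Binary.Bundles using (Poset)
open import Relation.Unary using (Pred; _⊆_; _≐_)

module _ {c ℓ₁ ℓ₂ : Level} (P : Poset c ℓ₁ ℓ₂) where
  open Theory P

  IsSup-resp-≐ : ∀ {a b} {S : Pred X a} {T : Pred X b} {y : X} →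
                 S ≐ T → IsSup S y → IsSup T y
  IsSup-resp-≐ (S⊆T , T⊆S) (ub , least) =
    (λ x x∈T → ub x (T⊆S x∈T)) , (λ u ubu → least u (λ x x∈S → ubu x (S⊆T x∈S)))

  IsSup-↓⇒IsSup : ∀ {a} {M : Pred X a} {s : X} → IsSup (↓ M) s → IsSup M s
  IsSup-↓⇒IsSup (ub , least) =
    (λ m m∈M → ub m (m , m∈M , refl)) ,
    (λ u ubu → least u (λ x (m , m∈M , x≤m) → trans x≤m (ubu m m∈M)))

  module _ {ℓ ℓm : Level} (𝓜 : Pred (Pred X ℓ) ℓm) where
    open WithM 𝓜

    In𝓜∧-resp-≐ : ∀ {a b} {S : Pred X a} {T : Pred X b} →
                  S ≐ T → In𝓜∧ S → In𝓜∧ T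
    In𝓜∧-resp-≐ (S⊆T , T⊆S) (M , M∈𝓜 , ↓M⊆S , S⊆↓M) =
      M , M∈𝓜 , (λ x∈↓M → S⊆T (↓M⊆S x∈↓M)) , (λ x∈T → S⊆↓M (T⊆S x∈T))

    ≪-monoʳ : ∀ {x y y′} → x ≪ y → y ≤ y′ → x ≪ y′
    ≪-monoʳ x≪y y≤y′ M M∈𝓜 s s=⋁M y′≤s = x≪y M M∈𝓜 s s=⋁M (trans y≤y′ y′≤s)

    ↠₁⇒≪ : ∀ {y x} → ↠₁ y x → x ≪ y
    ↠₁⇒≪ (y′ , y′≈y , x≪y′) = ≪-monoʳ x≪y′ (reflexive y′≈y)

    ≪⇒↠₁ : ∀ {y x} → x ≪ y → ↠₁ y x
    ≪⇒↠₁ {y} x≪y = y , Eq.refl , x≪y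

    IsSup-｛｝ : ∀ y → IsSup ｛ y ｝ y
    IsSup-｛｝ y = (λ x x≈y → reflexive x≈y) , (λ u ubu → ubu y Eq.refl)

    -- When 𝓜 contains all singletons, x ≪ y implies x ≤ y: test ≪ on the
    -- member of 𝓜 representing {y}, whose supremum is y.
    ≪⇒≤ : ContainsSingletons → ∀ {x y} → x ≪ y → x ≤ y
    ≪⇒≤ CS {x} {y} x≪y =
      let (M , M∈𝓜 , M⊆y , y⊆M) = CS y
          (m , m∈M , x≤m) = x≪y M M∈𝓜 y (IsSup-resp-≐ (y⊆M , M⊆y) (IsSup-｛｝ y)) refl
      in trans x≤m (reflexive (M⊆y m∈M))

    -- ↠(↠y) ⊆ ↠y: from x ≪ z ≪ y we get x ≪ z ≤ y, hence x ≪ y.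
    ↠↠⊆↠ : ContainsSingletons → ∀ y → ↠ (↠₁ y) ⊆ ↠₁ y
    ↠↠⊆↠ CS y (z , z∈↠y , x≪z) = ≪⇒↠₁ (≪-monoʳ x≪z (≪⇒≤ CS (↠₁⇒≪ z∈↠y)))

    interpolation⇒↠⊆↠↠ : Interpolation → ∀ y → ↠₁ y ⊆ ↠ (↠₁ y)
    interpolation⇒↠⊆↠↠ I y x∈↠y =
      let (z , x≪z , z≪y) = I _ y (↠₁⇒≪ x∈↠y) in z , ≪⇒↠₁ z≪y , x≪z

    ↠⊆↠↠⇒interpolation : (∀ y → ↠₁ y ⊆ ↠ (↠₁ y)) → Interpolation
    ↠⊆↠↠⇒interpolation ↠⊆↠↠ x z x≪z =
      let (w , w∈↠z , x≪w) = ↠⊆↠↠ z (≪⇒↠₁ x≪z) in w , x≪w , ↠₁⇒≪ w∈↠z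

    -- If every element is the supremum of its way-below set, then ↠ maps a
    -- set with supremum y to a set with supremum y: each z ∈ S is the join
    -- of ↠z ⊆ ↠S, so upper bounds of ↠S bound S.
    ↠-preserves-sup : (∀ z → IsSup (↠₁ z) z) →
                      ∀ {a} {S : Pred X a} {y} → IsSup S y → IsSup (↠ S) y
    ↠-preserves-sup ⋁↠ (ub , least) =
      (λ x (z , z∈S , x≪z) → trans (proj₁ (⋁↠ z) x (≪⇒↠₁ x≪z)) (ub z z∈S)) ,
      (λ u ubu → least u (λ z z∈S →
        proj₂ (⋁↠ z) u (λ x x∈↠z → ubu x (z , z∈S , ↠₁⇒≪ x∈↠z))))

    -- A set D ∈ 𝓜^∧ with supremum y contains everything way below y:
    -- writing D = ↓M with M ∈ 𝓜, y is also the supremum of M.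
    ≪-sup-of-𝓜∧ : ∀ {a} {D : Pred X a} {x y} →
                  In𝓜∧ D → IsSup D y → x ≪ y → D x
    ≪-sup-of-𝓜∧ {y = y} (M , M∈𝓜 , ↓M⊆D , D⊆↓M) y=⋁D x≪y =
      ↓M⊆D (x≪y M M∈𝓜 y (IsSup-↓⇒IsSup (IsSup-resp-≐ (D⊆↓M , ↓M⊆D) y=⋁D)) refl)

lemma3p14 : ∀ {c ℓ₁ ℓ₂ ℓ ℓm : Level} (P : Poset c ℓ₁ ℓ₂) (𝓜 : Pred (Pred (Theory.X P) ℓ) ℓm) →
    let open Theory P in let open WithM 𝓜 in
    ContainsSingletons →
    (Continuous → ∀ y → IsSup (↠ (↠₁ y)) y)
    × (StronglyContinuous ⇔ (∀ y → In𝓜∧ (↠ (↠₁ y)) × IsSup (↠ (↠₁ y)) y))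
lemma3p14 P 𝓜 CS = part1 , mk⇔ forward backward
  where
  open Theory P
  open WithM 𝓜

  part1 : Continuous → ∀ y → IsSup (↠ (↠₁ y)) y
  part1 C y = ↠-preserves-sup P 𝓜 (λ z → proj₂ (C z)) (proj₂ (C y))

  forward : StronglyContinuous → ∀ y → In𝓜∧ (↠ (↠₁ y)) × IsSup (↠ (↠₁ y)) y
  forward (C , I) y =
    In𝓜∧-resp-≐ P 𝓜 (interpolation⇒↠⊆↠↠ P 𝓜 I y , ↠↠⊆↠ P 𝓜 CS y) (proj₁ (C y)) ,
    part1 C y

  backward : (∀ y → In𝓜∧ (↠ (↠₁ y)) × IsSup (↠ (↠₁ y)) y) → StronglyContinuous
  backward H = C , ↠⊆↠↠⇒interpolation P 𝓜 ↠⊆↠↠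
    where
    ↠⊆↠↠ : ∀ y → ↠₁ y ⊆ ↠ (↠₁ y)
    ↠⊆↠↠ y x∈↠y = ≪-sup-of-𝓜∧ P 𝓜 (proj₁ (H y)) (proj₂ (H y)) (↠₁⇒≪ P 𝓜 x∈↠y)

    ↠↠≐↠ : ∀ y → ↠ (↠₁ y) ≐ ↠₁ y
    ↠↠≐↠ y = ↠↠⊆↠ P 𝓜 CS y , ↠⊆↠↠ y

    C : Continuous
    C y = In𝓜∧-resp-≐ P 𝓜 (↠↠≐↠ y) (proj₁ (H y)) , IsSup-resp-≐ P (↠↠≐↠ y) (proj₂ (H y))
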